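{- Let $A,C,D_0,D_1,\dots$ be formulas and define $U_0:=\Diamond\neg(D_0\rhd\neg C)$ and $U_{j+1}:=\Diamond\big((D_j\rhd D_{j+1})\wedge U_j\big)$. Let $\mathfrak{M}$ be a generalised Veltman model, $x$ a world of $\mathfrak{M}$ and $i\in\mathbb{N}$. If $\mathfrak{M},x\Vdash U_i$, then there exist worlds $y,z,x_0,\dots,x_i$ such that: (1) $x_i=x$; (2) $x_iRx_{i-1}R\cdots Rx_0RyRz$; (3) $\mathfrak{M},x_j\Vdash U_j$ for all $j\le i$; (4) $\mathfrak{M},x_j\Vdash D_j\rhd D_{j+1}$ for all $j<i$; (5) for every set $V$, if $zS_yV$ then $V\cap\{w:\mathfrak{M},w\Vdash C\}\neq\emptyset$; (6) $\mathfrak{M},z\Vdash D_0$.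
   Context: Formulas are built from propositional variables and $\bot$ using $\to$ (other Boolean connectives defined as usual), $\Box$ and binary $\rhd$; $\Diamond A:=\neg\Box\neg A$. A generalised Veltman model is $\langle W,R,\{S_w:w\in W\},V\rangle$ where $W\neq\emptyset$, $R$ is transitive and conversely well-founded, and for each $w$, with $R[w]=\{v:wRv\}$: $S_w\subseteq R[w]\times(\mathcal P(R[w])\setminus\{\emptyset\})$; $wRu$ implies $uS_w\{u\}$; if $uS_wV$ and $vS_wZ_v$ for all $v\in V$ then $uS_w\bigcup_{v\in V}Z_v$; $wRuRv$ implies $uS_w\{v\}$; if $uS_wV$ and $V\subseteq Z\subseteq R[w]$ then $uS_wZ$; and $V$ is a valuation. Forcing is classical for Boolean connectives, $w\Vdash\Box A$ iff all $R$-successors of $w$ force $A$, and $w\Vdash A\rhd B$ iff for every $u$ with $wRu$ and $u\Vdash A$ there is $V$ with $uS_wV$ and every element of $V$ forcing $B$. -}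

module Defs where

open import Level using (Level; Lift; 0ℓ) renaming (suc to lsuc)
open import Data.Nat using (ℕ; zero; suc)
open import Data.Empty using (⊥)
open import Data.Product using (Σ; _×_; ∃)
open import Relation.Binary.PropositionalEquality using (_≡_)
open import Induction.WellFounded using (WellFounded)

infixr 5 _⇒_
infix 6 _▷_
data Fm : Set where
  var  : ℕ → Fm
  ⊥'   : Fm
  _⇒_  : Fm → Fm → Fm
  □_   : Fm → Fm
  _▷_  : Fm → Fm → Fm

¬'_ : Fm → Fm
¬' A = A ⇒ ⊥'

_∧'_ : Fm → Fm → Fm
A ∧' B = ¬' (A ⇒ ¬' B)

◇_ : Fm → Fm
◇ A = ¬' (□ (¬' A))

U : Fm → (ℕ → Fm) → ℕ → Fm
U C D zero    = ◇ (¬' (D 0 ▷ ¬' C))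
U C D (suc j) = ◇ ((D j ▷ D (suc j)) ∧' U C D j)

record GVModel : Set₁ where
  field
    W    : Set
    w₀   : W
    R    : W → W → Set
    S    : W → W → (W → Set) → Set             -- S w u V  means  u S_w V
    Val  : W → ℕ → Set
    R-trans : ∀ {a b c} → R a b → R b c → R a c
    R-cwf   : WellFounded (λ b a → R a b)
    S-dom   : ∀ {w u V} → S w u V → R w u
    S-cod   : ∀ {w u V} → S w u V → ∀ v → V v → R w v
    S-ne    : ∀ {w u V} → S w u V → ∃ λ v → V v
    S-refl  : ∀ {w u} → R w u → S w u (λ v → v ≡ u)
    -- if u S_w V and v S_w Z_v for all v ∈ V, then u S_w ⋃_{v∈V} Z_v
    S-trans : ∀ {w u} {V : W → Set} (Z : (v : W) → V v → W → Set) →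
              S w u V → (∀ v (p : V v) → S w v (Z v p)) →
              S w u (λ t → Σ W λ v → Σ (V v) λ p → Z v p t)
    S-R     : ∀ {w u v} → R w u → R u v → S w u (λ t → t ≡ v)
    S-mono  : ∀ {w u} {V Z : W → Set} → S w u V →
              (∀ t → V t → Z t) → (∀ t → Z t → R w t) → S w u Z

module _ (M : GVModel) where
  open GVModel M

  infix 4 _⊩_
  _⊩_ : W → Fm → Set₁
  w ⊩ var p   = Lift (lsuc 0ℓ) (Val w p)
  w ⊩ ⊥'      = Lift (lsuc 0ℓ) ⊥
  w ⊩ (A ⇒ B) = w ⊩ A → w ⊩ B
  w ⊩ (□ A)   = ∀ v → R w v → v ⊩ A
  w ⊩ (A ▷ B) = ∀ u → R w u → u ⊩ A →
                Σ (W → Set) λ V → S w u V × (∀ v → V v → v ⊩ B)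

module Submission where

-- U_{i+1} = ◇((D_i ▷ D_{i+1}) ∧ U_i), so a world forcing U_{i+1}
-- has a successor forcing both D_i ▷ D_{i+1} and U_i; iterating this i times
-- walks down an R-chain x = x_i R x_{i-1} R … R x_0 of worlds forcing U_j.
-- At the bottom, x_0 ⊩ U_0 = ◇¬(D_0 ▷ ¬C) gives a successor y refuting
-- D_0 ▷ ¬C, i.e. a z with y R z, z ⊩ D_0 and no S_y-set from z avoiding C.

open import Defs
open import Level using (Level; 0ℓ; lift; lower) renaming (suc to lsuc)
open import Axiom.ExcludedMiddle using (ExcludedMiddle)
open import Axiom.DoubleNegationElimination using (em⇒dne)
open import Data.Nat using (ℕ; zero; suc; _<_; _≤_; z≤n; s≤s)
open import Data.Nat.Properties using (_≟_; <⇒≢; ≤-pred; m≤n⇒m<n∨m≡n; m<n⇒m<1+n; n<1+n)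
open import Data.Product using (Σ; _×_; _,_)
open import Data.Sum using (inj₁; inj₂)
open import Data.Empty using (⊥-elim)
open import Relation.Nullary using (¬_; yes; no)
open import Relation.Binary.PropositionalEquality using (_≡_; refl; sym; subst; subst₂)

module Overwrite {ℓ : Level} {A : Set ℓ} where

  _[_≔_] : (ℕ → A) → ℕ → A → ℕ → A
  (xs [ n ≔ a ]) j with j ≟ n
  ... | yes _ = a
  ... | no _  = xs j

  ≔-hit : ∀ xs n (a : A) → (xs [ n ≔ a ]) n ≡ a
  ≔-hit xs n a with n ≟ n
  ... | yes _  = refl
  ... | no n≢n = ⊥-elim (n≢n refl)

  ≔-below : ∀ xs n (a : A) {j} → j < n → (xs [ n ≔ a ]) j ≡ xs j
  ≔-below xs n a {j} j<n with j ≟ n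
  ... | yes j≡n = ⊥-elim (<⇒≢ j<n j≡n)
  ... | no _    = refl

open Overwrite

up-to : ∀ {ℓ} {Q : ℕ → Set ℓ} {i} → (∀ j → j < i → Q j) → Q i → ∀ j → j ≤ i → Q j
up-to below at j j≤i with m≤n⇒m<n∨m≡n j≤i
... | inj₁ j<i  = below j j<i
... | inj₂ refl = at

module Classical (em : ExcludedMiddle (lsuc 0ℓ)) (M : GVModel) where
  open GVModel M

  infix 4 _⊨_
  _⊨_ : W → Fm → Set₁
  _⊨_ = _⊩_ M

  private
    by-contradiction : {P : Set₁} → ¬ ¬ P → P
    by-contradiction = em⇒dne em

  Blocks : W → W → Fm → Set₁
  Blocks y z B = ∀ (V : W → Set) → S y z V → Σ W λ w → V w × w ⊨ B

  ◇-elim : ∀ {x} A → x ⊨ ◇ A → Σ W λ v → R x v × v ⊨ A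
  ◇-elim A x⊨◇A = by-contradiction λ no-succ →
    lower (x⊨◇A λ v x-R-v v⊨A → lift (no-succ (v , x-R-v , v⊨A)))

  ∧-elimˡ : ∀ {v} A B → v ⊨ (A ∧' B) → v ⊨ A
  ∧-elimˡ A B v⊨A∧B = by-contradiction λ v⊭A →
    lower (v⊨A∧B λ v⊨A → ⊥-elim (v⊭A v⊨A))

  ∧-elimʳ : ∀ {v} A B → v ⊨ (A ∧' B) → v ⊨ B
  ∧-elimʳ A B v⊨A∧B = by-contradiction λ v⊭B →
    lower (v⊨A∧B λ _ v⊨B → ⊥-elim (v⊭B v⊨B))

  blocks-if-unavoidable : ∀ {y u} B →
    ¬ (Σ (W → Set) λ V → S y u V × (∀ w → V w → w ⊨ ¬' B)) → Blocks y u B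
  blocks-if-unavoidable B unavoidable V y-S-V = by-contradiction λ misses →
    unavoidable (V , y-S-V , λ w w∈V w⊨B → lift (misses (w , w∈V , w⊨B)))

  ¬▷-elim : ∀ {y} A B → y ⊨ ¬' (A ▷ ¬' B) → Σ W λ z → R y z × z ⊨ A × Blocks y z B
  ¬▷-elim A B y⊭A▷¬B = by-contradiction λ no-witness →
    lower (y⊭A▷¬B λ u y-R-u u⊨A → by-contradiction λ unavoidable →
      no-witness (u , y-R-u , u⊨A , blocks-if-unavoidable B unavoidable))

module Chains (em : ExcludedMiddle (lsuc 0ℓ)) (C : Fm) (D : ℕ → Fm) (M : GVModel) where
  open GVModel M
  open Classical em M

  record Chain (i : ℕ) (xs : ℕ → W) : Set₁ where
    field
      descending : ∀ j → j < i → R (xs (suc j)) (xs j)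
      forces-U   : ∀ j → j ≤ i → xs j ⊨ U C D j
      forces-▷   : ∀ j → j < i → xs j ⊨ (D j ▷ D (suc j))

  chain-base : ∀ {x} → x ⊨ U C D 0 → Chain 0 (λ _ → x)
  chain-base x⊨U₀ = record
    { descending = λ _ ()
    ; forces-U   = λ { zero z≤n → x⊨U₀ }
    ; forces-▷   = λ _ ()
    }

  chain-extend : ∀ {i xs x} → Chain i xs → R x (xs i) →
    x ⊨ U C D (suc i) → xs i ⊨ (D i ▷ D (suc i)) → Chain (suc i) (xs [ suc i ≔ x ])
  chain-extend {i} {xs} {x} chain x-R-top x⊨U top⊨▷ = record
    { descending = λ j j<1+i → up-to {Q = λ j → R (xs′ (suc j)) (xs′ j)}
        (λ j j<i → subst₂ R (sym (kept (s≤s j<i))) (sym (kept (m<n⇒m<1+n j<i)))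
                          (descending j j<i))
        (subst₂ R (sym (≔-hit xs (suc i) x)) (sym (kept (n<1+n i))) x-R-top)
        j (≤-pred j<1+i)
    ; forces-U = up-to {Q = λ j → xs′ j ⊨ U C D j}
        (λ j j<1+i → subst (_⊨ U C D j) (sym (kept j<1+i)) (forces-U j (≤-pred j<1+i)))
        (subst (_⊨ U C D (suc i)) (sym (≔-hit xs (suc i) x)) x⊨U)
    ; forces-▷ = λ j j<1+i → subst (_⊨ (D j ▷ D (suc j))) (sym (kept j<1+i))
        (up-to {Q = λ j → xs j ⊨ (D j ▷ D (suc j))} forces-▷ top⊨▷ j (≤-pred j<1+i))
    }
    where
    open Chain chain
    xs′ : ℕ → W
    xs′ = xs [ suc i ≔ x ]
    kept : ∀ {j} → j < suc i → xs′ j ≡ xs j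
    kept = ≔-below xs (suc i) x

  record Witness (i : ℕ) (x : W) : Set₁ where
    field
      y z    : W
      xs     : ℕ → W
      top    : xs i ≡ x
      chain  : Chain i xs
      bottom : R (xs 0) y
      y-R-z  : R y z
      blocks : Blocks y z C
      z⊨D₀   : z ⊨ D 0

  witness : ∀ i x → x ⊨ U C D i → Witness i x
  witness zero x x⊨U₀ with ◇-elim (¬' (D 0 ▷ ¬' C)) x⊨U₀
  ... | y , x-R-y , y⊭D₀▷¬C with ¬▷-elim (D 0) C y⊭D₀▷¬C
  ... | z , y-R-z , z⊨D₀ , blocks = record
    { y = y ; z = z ; xs = λ _ → x ; top = refl ; chain = chain-base x⊨U₀
    ; bottom = x-R-y ; y-R-z = y-R-z ; blocks = blocks ; z⊨D₀ = z⊨D₀ }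
  witness (suc i) x x⊨U with ◇-elim ((D i ▷ D (suc i)) ∧' U C D i) x⊨U
  ... | x′ , x-R-x′ , x′⊨▷∧U
    with witness i x′ (∧-elimʳ (D i ▷ D (suc i)) (U C D i) x′⊨▷∧U)
  ... | record { xs = xs ; top = refl ; chain = chain ; bottom = bottom
               ; y = y ; z = z ; y-R-z = y-R-z ; blocks = blocks ; z⊨D₀ = z⊨D₀ } = record
    { y = y ; z = z ; xs = xs [ suc i ≔ x ] ; top = ≔-hit xs (suc i) x
    ; chain = chain-extend chain x-R-x′ x⊨U (∧-elimˡ (D i ▷ D (suc i)) (U C D i) x′⊨▷∧U)
    ; bottom = subst (λ w → R w y) (sym (≔-below xs (suc i) x (s≤s z≤n))) bottom
    ; y-R-z = y-R-z ; blocks = blocks ; z⊨D₀ = z⊨D₀ }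

lemma8p2 : ExcludedMiddle (lsuc 0ℓ) →
    (C : Fm) (D : ℕ → Fm) (M : GVModel) (x : GVModel.W M) (i : ℕ) →
    _⊩_ M x (U C D i) →
    Σ (GVModel.W M) λ y → Σ (GVModel.W M) λ z → Σ (ℕ → GVModel.W M) λ xs →
    (xs i ≡ x)
    × (∀ j → j < i → GVModel.R M (xs (suc j)) (xs j))
    × GVModel.R M (xs 0) y
    × GVModel.R M y z
    × (∀ j → j ≤ i → _⊩_ M (xs j) (U C D j))
    × (∀ j → j < i → _⊩_ M (xs j) (D j ▷ D (suc j)))
    × (∀ (V : GVModel.W M → Set) → GVModel.S M y z V →
    Σ (GVModel.W M) λ w → V w × _⊩_ M w C)
    × _⊩_ M z (D 0)
lemma8p2 em C D M x i x⊨U =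
  y , z , xs , top , descending , bottom , y-R-z , forces-U , forces-▷ , blocks , z⊨D₀
  where
  open Chains em C D M
  open Witness (witness i x x⊨U)
  open Chain chain
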